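{- Let $q$ be a prime power, let $s$ be a positive divisor of $q-1$, let $r$ be a positive integer with $s\nmid r$, let $B(X)\in\mathbb{F}_q[X]$, and let $f(X)=X^rB(X^s)$. Then $S(f)=0$.
   Context: For $f(X)\in\mathbb{F}_q[X]$, $S(f)$ denotes the sum of the elements of the value set $f(\mathbb{F}_q)=\{f(x):x\in\mathbb{F}_q\}$ (each value counted once). -}

module Defs where

open import Level using (Level; _⊔_) renaming (suc to lsuc)
open import Algebra.Bundles using (CommutativeRing)
open import Data.List using (List; []; _∷_; length; foldr)
open import Data.Nat using (ℕ; zero; suc)
open import Data.Product using (∃)
open import Relation.Nullary using (¬_; yes; no)
open import Relation.Binary.Definitions using (Decidable)
import Data.List.Relation.Unary.Unique.Setoid as UniqueS
import Data.List.Membership.Setoid as MemS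
import Data.List.Membership.DecSetoid as DecMemS
open import Relation.Binary.Bundles using (DecSetoid)

record FiniteField (c ℓ : Level) : Set (lsuc (c ⊔ ℓ)) where
  field
    commRing : CommutativeRing c ℓ
  open CommutativeRing commRing public
  field
    _≟_      : Decidable _≈_
    0≉1      : ¬ (0# ≈ 1#)
    inverse  : ∀ x → ¬ (x ≈ 0#) → ∃ λ y → x * y ≈ 1#
    elems    : List Carrier
    unique   : UniqueS.Unique setoid elems
    complete : ∀ x → MemS._∈_ setoid x elems

  card : ℕ
  card = length elems

  decSetoid : DecSetoid c ℓ
  decSetoid = record { isDecEquivalence = record { isEquivalence = isEquivalence ; _≟_ = _≟_ } }

  pow : Carrier → ℕ → Carrier
  pow x zero    = 1#
  pow x (suc n) = x * pow x n

  -- polynomials as coefficient lists, lowest degree first; Horner evaluation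
  eval : List Carrier → Carrier → Carrier
  eval []       x = 0#
  eval (a ∷ as) x = a + x * eval as x

  insertNew : Carrier → List Carrier → List Carrier
  insertNew y ys with DecMemS._∈?_ decSetoid y ys
  ... | yes _ = ys
  ... | no  _ = y ∷ ys

  valueSet : (Carrier → Carrier) → List Carrier
  valueSet f = foldr (λ x acc → insertNew (f x) acc) [] elems

  sumList : List Carrier → Carrier
  sumList = foldr _+_ 0#

  S : (Carrier → Carrier) → Carrier
  S f = sumList (valueSet f)

{-# OPTIONS --safe #-}
module Submission where

-- Because s ∣ q − 1 but s ∤ r, some ω has ω^s = 1 and ζ = ω^r ≠ 1. Otherwise,
-- writing q − 1 = ms, every unit x would satisfy x^(mr) = 1, hence x^k = 1 for
-- k = mr mod (q − 1) by Fermat; but a polynomial of degree < q − 1 with q − 1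
-- roots vanishes identically, so k = 0 and s ∣ r. Since f(ωx) = ζ f(x),
-- multiplication by ζ permutes the value set of f, so its sum S satisfies
-- ζ S = S, which forces S = 0.

open import Defs
open import Level using (Level)
open import Data.List using (List; []; _∷_; _++_; length; map; foldr; filter)
open import Data.List.Properties using (length-map; filter-all)
open import Data.List.Relation.Unary.Any using (here; there; any?; satisfied)
open import Data.List.Relation.Unary.All as All using (All; _∷_)
open import Data.List.Relation.Unary.AllPairs using ([]; _∷_)
open import Data.Nat as ℕ using (ℕ; zero; suc; _∸_; _≤_; _<_; _≥_; s≤s; NonZero; ≢-nonZero⁻¹)
open import Data.Nat.Properties as ℕₚ using (suc-injective; <⇒≱; ≮⇒≥)
open import Data.Nat.DivMod using (_%_; _/_; m≡m%n+[m/n]*n; m%n<n)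
open import Data.Nat.Divisibility using (_∣_; divides; m%n≡0⇒n∣m; *-cancelˡ-∣)
open import Data.Product using (_×_; _,_; ∃; proj₂; uncurry)
open import Data.Sum using (_⊎_; inj₁; inj₂)
open import Function using (_∘_)
open import Relation.Binary.Bundles using (Setoid)
open import Relation.Binary.PropositionalEquality as ≡ using (_≡_)
open import Relation.Nullary using (¬_; Dec; yes; no; ¬?; contradiction)
open import Relation.Nullary.Decidable using (_×-dec_; decidable-stable)
import Algebra.Properties.CommutativeSemiring.Exp as Exp
import Algebra.Properties.Group as GroupProperties
import Algebra.Properties.Ring as RingProperties
import Algebra.Solver.Ring.NaturalCoefficients.Default as Solver
import Data.List.Membership.Setoid as Membership
import Data.List.Membership.Setoid.Properties as MembershipProperties
import Data.List.Membership.DecSetoid as DecMembership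
import Data.List.Relation.Binary.Permutation.Setoid as Permutation
import Data.List.Relation.Binary.Permutation.Setoid.Properties as PermutationProperties
import Data.List.Relation.Unary.Unique.Setoid as Unique
import Data.List.Relation.Unary.Unique.Setoid.Properties as UniqueProperties
import Relation.Binary.Reasoning.Setoid as SetoidReasoning

module _ {a ℓ} (S : Setoid a ℓ) where
  open Setoid S
  open Membership S using (_∈_)
  open Unique S using (Unique)
  open Permutation S using (_↭_; prep; ↭-refl; ↭-sym; ↭-trans; ↭-transˡ-≋)
  open PermutationProperties S using (shift; ∈-resp-↭; xs↭ys⇒|xs|≡|ys|)

  unique-⊆-≡length⇒↭ : ∀ xs {ys} → Unique xs → (∀ {z} → z ∈ xs → z ∈ ys) →
                       length xs ≡ length ys → xs ↭ ys
  unique-⊆-≡length⇒↭ [] {[]} _ _ _ = ↭-refl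
  unique-⊆-≡length⇒↭ (x ∷ xs) {ys} (x∉xs ∷ xs!) xs⊆ys |xs|≡|ys|
    with ys₁ , ys₂ , w , x≈w , ys≋ ← MembershipProperties.∈-∃++ S (xs⊆ys (here refl)) =
    ↭-trans (prep x≈w (unique-⊆-≡length⇒↭ xs xs! xs⊆rest |xs|≡|rest|)) (↭-sym ys↭w∷rest)
    where
      rest : List Carrier
      rest = ys₁ ++ ys₂

      ys↭w∷rest : ys ↭ w ∷ rest
      ys↭w∷rest = ↭-transˡ-≋ ys≋ (shift refl ys₁ ys₂)

      xs⊆rest : ∀ {z} → z ∈ xs → z ∈ rest
      xs⊆rest z∈xs with ∈-resp-↭ ys↭w∷rest (xs⊆ys (there z∈xs))
      ... | here z≈w    = contradiction (trans x≈w (sym z≈w))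
                            (All.lookupₛ S (λ y≈z x≉y x≈z → x≉y (trans x≈z (sym y≈z))) x∉xs z∈xs)
      ... | there z∈rest = z∈rest

      |xs|≡|rest| : length xs ≡ length rest
      |xs|≡|rest| = suc-injective (≡.trans |xs|≡|ys| (xs↭ys⇒|xs|≡|ys| ys↭w∷rest))

module _ {c ℓ} (F : FiniteField c ℓ) where
  open FiniteField F
  open Exp commutativeSemiring using (_^_; ^-congˡ; ^-assocʳ; ^-homo-*; ^-distrib-*)
  open GroupProperties +-group using (x∙y⁻¹≈ε⇒x≈y)
  open RingProperties ring using (x[y-z]≈xy-xz; [y-z]x≈yx-zx)
  open Solver commutativeSemiring using (solve; _:=_; _:+_; _:*_; con)
  open SetoidReasoning setoid
  open Membership setoid using (_∈_; lose)
  open MembershipProperties using (∈-resp-≈; ∈-map⁻; ∈-filter⁺; ∈-filter⁻)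
  open DecMembership decSetoid using (_∈?_)
  open Unique setoid using (Unique)
  open Permutation setoid using (_↭_)
  open PermutationProperties setoid using (foldr-commMonoid)

  pow≈^ : ∀ x n → pow x n ≈ x ^ n
  pow≈^ x zero    = refl
  pow≈^ x (suc n) = *-congˡ (pow≈^ x n)

  x-y≈0⇒x≈y : ∀ {x y} → x - y ≈ 0# → x ≈ y
  x-y≈0⇒x≈y = x∙y⁻¹≈ε⇒x≈y _ _

  nonzero-cancelˡ : ∀ {x y} → ¬ x ≈ 0# → x * y ≈ 0# → y ≈ 0#
  nonzero-cancelˡ {x} {y} x≉0 xy≈0 with x⁻¹ , xx⁻¹≈1 ← inverse x x≉0 = begin
    y              ≈⟨ *-identityˡ y ⟨
    1# * y         ≈⟨ *-congʳ xx⁻¹≈1 ⟨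
    (x * x⁻¹) * y  ≈⟨ solve 3 (λ x x⁻¹ y → (x :* x⁻¹) :* y := x⁻¹ :* (x :* y)) refl x x⁻¹ y ⟩
    x⁻¹ * (x * y)  ≈⟨ *-congˡ xy≈0 ⟩
    x⁻¹ * 0#       ≈⟨ zeroʳ x⁻¹ ⟩
    0#             ∎

  *-nonzero : ∀ {x y} → ¬ x ≈ 0# → ¬ y ≈ 0# → ¬ x * y ≈ 0#
  *-nonzero x≉0 y≉0 = y≉0 ∘ nonzero-cancelˡ x≉0

  ^-nonzero : ∀ {x} n → ¬ x ≈ 0# → ¬ x ^ n ≈ 0#
  ^-nonzero zero    x≉0 = 0≉1 ∘ sym
  ^-nonzero (suc n) x≉0 = *-nonzero x≉0 (^-nonzero n x≉0)

  1^n≈1 : ∀ n → 1# ^ n ≈ 1#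
  1^n≈1 zero    = refl
  1^n≈1 (suc n) = trans (*-identityˡ _) (1^n≈1 n)

  *-cancelˡ-nonzero : ∀ {x y z} → ¬ x ≈ 0# → x * y ≈ x * z → y ≈ z
  *-cancelˡ-nonzero {x} {y} {z} x≉0 xy≈xz = x-y≈0⇒x≈y (nonzero-cancelˡ x≉0 (begin
    x * (y - z)    ≈⟨ x[y-z]≈xy-xz x y z ⟩
    x * y - x * z  ≈⟨ +-congʳ xy≈xz ⟩
    x * z - x * z  ≈⟨ -‿inverseʳ (x * z) ⟩
    0#             ∎))

  ζx≈x⇒x≈0 : ∀ {ζ x} → ¬ ζ ≈ 1# → ζ * x ≈ x → x ≈ 0#
  ζx≈x⇒x≈0 {ζ} {x} ζ≉1 ζx≈x = nonzero-cancelˡ (ζ≉1 ∘ x-y≈0⇒x≈y) (begin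
    (ζ - 1#) * x     ≈⟨ [y-z]x≈yx-zx x ζ 1# ⟩
    ζ * x - 1# * x   ≈⟨ +-cong ζx≈x (-‿cong (*-identityˡ x)) ⟩
    x - x            ≈⟨ -‿inverseʳ x ⟩
    0#               ∎)

  product : List Carrier → Carrier
  product = foldr _*_ 1#

  sum-map-* : ∀ a xs → sumList (map (a *_) xs) ≈ a * sumList xs
  sum-map-* a []       = sym (zeroʳ a)
  sum-map-* a (x ∷ xs) = trans (+-congˡ (sum-map-* a xs)) (sym (distribˡ a x (sumList xs)))

  product-map-* : ∀ a xs → product (map (a *_) xs) ≈ a ^ length xs * product xs
  product-map-* a []       = sym (*-identityʳ 1#)
  product-map-* a (x ∷ xs) = trans (*-congˡ (product-map-* a xs))
    (solve 4 (λ a x aⁿ p → (a :* x) :* (aⁿ :* p) := (a :* aⁿ) :* (x :* p)) refl a x (a ^ length xs) (product xs))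

  product-nonzero : ∀ xs → (∀ {x} → x ∈ xs → ¬ x ≈ 0#) → ¬ product xs ≈ 0#
  product-nonzero []       _      = 0≉1 ∘ sym
  product-nonzero (x ∷ xs) xs≉0 = *-nonzero (xs≉0 (here refl)) (product-nonzero xs (xs≉0 ∘ there))

  scaling-↭ : ∀ {a xs} → Unique xs → ¬ a ≈ 0# → (∀ {x} → x ∈ xs → a * x ∈ xs) → map (a *_) xs ↭ xs
  scaling-↭ {a} {xs} xs! a≉0 closed =
    unique-⊆-≡length⇒↭ setoid (map (a *_) xs)
      (UniqueProperties.map⁺ setoid setoid (*-cancelˡ-nonzero a≉0) xs!) ax∈xs (length-map (a *_) xs)
    where
      ax∈xs : ∀ {z} → z ∈ map (a *_) xs → z ∈ xs
      ax∈xs z∈ with x , x∈xs , z≈ax ← ∈-map⁻ setoid setoid z∈ = ∈-resp-≈ setoid (sym z≈ax) (closed x∈xs)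

  sum≈0-if-scaling-invariant : ∀ {ζ xs} → Unique xs → ¬ ζ ≈ 0# → ¬ ζ ≈ 1# →
                               (∀ {x} → x ∈ xs → ζ * x ∈ xs) → sumList xs ≈ 0#
  sum≈0-if-scaling-invariant {ζ} {xs} xs! ζ≉0 ζ≉1 closed = ζx≈x⇒x≈0 ζ≉1 (begin
    ζ * sumList xs           ≈⟨ sum-map-* ζ xs ⟨
    sumList (map (ζ *_) xs)  ≈⟨ foldr-commMonoid +-isCommutativeMonoid (scaling-↭ xs! ζ≉0 closed) ⟩
    sumList xs               ∎)

  eval-cong : ∀ p {x y} → x ≈ y → eval p x ≈ eval p y
  eval-cong []      x≈y = refl
  eval-cong (a ∷ p) x≈y = +-congˡ (*-cong x≈y (eval-cong p x≈y))

  quotient : Carrier → List Carrier → List Carrier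
  quotient c []           = []
  quotient c (_ ∷ [])     = []
  quotient c (_ ∷ b ∷ bs) = eval (b ∷ bs) c ∷ quotient c (b ∷ bs)

  length-quotient : ∀ c a p → length (quotient c (a ∷ p)) ≡ length p
  length-quotient c a []      = ≡.refl
  length-quotient c a (b ∷ p) = ≡.cong suc (length-quotient c b p)

  eval-quotient : ∀ c p y → eval p y ≈ (y - c) * eval (quotient c p) y + eval p c
  eval-quotient c [] y = sym (trans (+-identityʳ _) (zeroʳ _))
  eval-quotient c (a ∷ []) y =
    solve 4 (λ a y d c → a :+ y :* con 0 := d :* con 0 :+ (a :+ c :* con 0)) refl a y (y - c) c
  eval-quotient c (a ∷ b ∷ bs) y = begin
    a + y * P                               ≈⟨ +-congˡ (*-cong y≈d+c (eval-quotient c (b ∷ bs) y)) ⟩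
    a + (d + c) * (d * Q + R)               ≈⟨ solve 5 (λ a d c Q R → a :+ (d :+ c) :* (d :* Q :+ R)
                                                              := d :* (R :+ (d :+ c) :* Q) :+ (a :+ c :* R))
                                                      refl a d c Q R ⟩
    d * (R + (d + c) * Q) + (a + c * R)     ≈⟨ +-congʳ (*-congˡ (+-congˡ (*-congʳ y≈d+c))) ⟨
    d * (R + y * Q) + (a + c * R)           ∎
    where
      d P Q R : Carrier
      d = y - c
      P = eval (b ∷ bs) y
      Q = eval (quotient c (b ∷ bs)) y
      R = eval (b ∷ bs) c
      y≈d+c : y ≈ d + c
      y≈d+c = sym (trans (+-assoc y (- c) c) (trans (+-congˡ (-‿inverseˡ c)) (+-identityʳ y)))

  roots≥length⇒eval≈0 : ∀ xs p → Unique xs → length p ≤ length xs → All (λ x → eval p x ≈ 0#) xs →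
                        ∀ y → eval p y ≈ 0#
  roots≥length⇒eval≈0 xs       []      _            _              _              y = refl
  roots≥length⇒eval≈0 (x ∷ xs) (a ∷ p) (x∉xs ∷ xs!) (s≤s |p|≤|xs|) (px≈0 ∷ pxs≈0) y = begin
    eval (a ∷ p) y                       ≈⟨ eval-quotient x (a ∷ p) y ⟩
    (y - x) * eval q y + eval (a ∷ p) x  ≈⟨ +-cong (*-congˡ (roots≥length⇒eval≈0 xs q xs! |q|≤|xs| qxs≈0 y)) px≈0 ⟩
    (y - x) * 0# + 0#                    ≈⟨ trans (+-identityʳ _) (zeroʳ _) ⟩
    0#                                   ∎
    where
      q : List Carrier
      q = quotient x (a ∷ p)

      |q|≤|xs| : length q ≤ length xs
      |q|≤|xs| = ≡.subst (_≤ length xs) (≡.sym (length-quotient x a p)) |p|≤|xs|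

      q-vanishes : ∀ {z} → ¬ x ≈ z → eval (a ∷ p) z ≈ 0# → eval q z ≈ 0#
      q-vanishes {z} x≉z pz≈0 = nonzero-cancelˡ (x≉z ∘ sym ∘ x-y≈0⇒x≈y) (begin
        (z - x) * eval q z                   ≈⟨ +-identityʳ _ ⟨
        (z - x) * eval q z + 0#              ≈⟨ +-congˡ px≈0 ⟨
        (z - x) * eval q z + eval (a ∷ p) x  ≈⟨ eval-quotient x (a ∷ p) z ⟨
        eval (a ∷ p) z                       ≈⟨ pz≈0 ⟩
        0#                                   ∎)

      qxs≈0 : All (λ z → eval q z ≈ 0#) xs
      qxs≈0 = All.zipWith (uncurry q-vanishes) (x∉xs , pxs≈0)

  monomial : ℕ → List Carrier
  monomial zero    = 1# ∷ []
  monomial (suc k) = 0# ∷ monomial k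

  length-monomial : ∀ k → length (monomial k) ≡ suc k
  length-monomial zero    = ≡.refl
  length-monomial (suc k) = ≡.cong suc (length-monomial k)

  eval-monomial : ∀ k y → eval (monomial k) y ≈ y ^ k
  eval-monomial zero    y = trans (+-congˡ (zeroʳ y)) (+-identityʳ 1#)
  eval-monomial (suc k) y = trans (+-identityˡ _) (*-congˡ (eval-monomial k y))

  nonzero? : ∀ x → Dec (¬ x ≈ 0#)
  nonzero? x = ¬? (x ≟ 0#)

  nonzeros : List Carrier
  nonzeros = filter nonzero? elems

  nonzero-resp : ∀ {x y} → x ≈ y → ¬ x ≈ 0# → ¬ y ≈ 0#
  nonzero-resp x≈y x≉0 = x≉0 ∘ trans x≈y

  nonzeros-unique : Unique nonzeros
  nonzeros-unique = UniqueProperties.filter⁺ setoid nonzero? unique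

  ∈-nonzeros⁺ : ∀ {x} → ¬ x ≈ 0# → x ∈ nonzeros
  ∈-nonzeros⁺ x≉0 = ∈-filter⁺ setoid nonzero? nonzero-resp (complete _) x≉0

  ∈-nonzeros⁻ : ∀ {x} → x ∈ nonzeros → ¬ x ≈ 0#
  ∈-nonzeros⁻ x∈ = proj₂ (∈-filter⁻ setoid nonzero? nonzero-resp {xs = elems} x∈)

  length-filter-nonzero : ∀ xs → Unique xs → 0# ∈ xs → length xs ≡ suc (length (filter nonzero? xs))
  length-filter-nonzero (x ∷ xs) (x∉xs ∷ xs!) 0∈ with x ≟ 0#
  ... | yes x≈0 = ≡.cong (suc ∘ length) (≡.sym (filter-all nonzero? xs≉0))
    where
      xs≉0 : All (λ z → ¬ z ≈ 0#) xs
      xs≉0 = All.map (λ x≉z z≈0 → x≉z (trans x≈0 (sym z≈0))) x∉xs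
  ... | no x≉0 with 0∈
  ...   | here 0≈x    = contradiction (sym 0≈x) x≉0
  ...   | there 0∈xs = ≡.cong suc (length-filter-nonzero xs xs! 0∈xs)

  #units : ℕ
  #units = length nonzeros

  card≡1+#units : card ≡ suc #units
  card≡1+#units = length-filter-nonzero elems unique (complete 0#)

  instance
    #units-nonZero : NonZero #units
    #units-nonZero with nonzeros | ∈-nonzeros⁺ (0≉1 ∘ sym)
    ... | _ ∷ _ | _ = _

  fermat : ∀ {x} → ¬ x ≈ 0# → x ^ #units ≈ 1#
  fermat {x} x≉0 = *-cancelˡ-nonzero (product-nonzero nonzeros ∈-nonzeros⁻) (begin
    P * x ^ #units                 ≈⟨ *-comm P _ ⟩
    x ^ #units * P                 ≈⟨ product-map-* x nonzeros ⟨
    product (map (x *_) nonzeros)  ≈⟨ foldr-commMonoid *-isCommutativeMonoid (scaling-↭ nonzeros-unique x≉0 closed) ⟩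
    P                              ≈⟨ *-identityʳ P ⟨
    P * 1#                         ∎)
    where
      P : Carrier
      P = product nonzeros

      closed : ∀ {y} → y ∈ nonzeros → x * y ∈ nonzeros
      closed = ∈-nonzeros⁺ ∘ *-nonzero x≉0 ∘ ∈-nonzeros⁻

  ^-%-#units : ∀ {x} e → ¬ x ≈ 0# → x ^ (e % #units) ≈ x ^ e
  ^-%-#units {x} e x≉0 = begin
    x ^ (e % #units)                          ≈⟨ *-identityʳ _ ⟨
    x ^ (e % #units) * 1#                     ≈⟨ *-congˡ (trans (^-congˡ t (fermat x≉0)) (1^n≈1 t)) ⟨
    x ^ (e % #units) * (x ^ #units) ^ t       ≈⟨ *-congˡ (^-assocʳ x #units t) ⟩
    x ^ (e % #units) * x ^ (#units ℕ.* t)     ≈⟨ ^-homo-* x (e % #units) (#units ℕ.* t) ⟨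
    x ^ (e % #units ℕ.+ #units ℕ.* t)         ≡⟨ ≡.cong (λ n → x ^ (e % #units ℕ.+ n)) (ℕₚ.*-comm #units t) ⟩
    x ^ (e % #units ℕ.+ t ℕ.* #units)         ≡⟨ ≡.cong (x ^_) (m≡m%n+[m/n]*n e #units) ⟨
    x ^ e                                     ∎
    where
      t : ℕ
      t = e / #units

  #units≤exponent : ∀ k → (∀ {x} → ¬ x ≈ 0# → x ^ suc k ≈ 1#) → #units ≤ suc k
  #units≤exponent k xᵏ⁺¹≈1 = ≮⇒≥ λ k+1<#units → 0≉1 (begin
    0#          ≈⟨ -‿inverseʳ 1# ⟨
    1# + - 1#   ≈⟨ +-congˡ (-1≈0 k+1<#units) ⟩
    1# + 0#     ≈⟨ +-identityʳ 1# ⟩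
    1#          ∎)
    where
      p : List Carrier
      p = - 1# ∷ monomial k

      p-vanishes-on-units : All (λ x → eval p x ≈ 0#) nonzeros
      p-vanishes-on-units = All.tabulateₛ setoid λ {x} x∈ → begin
        - 1# + x * eval (monomial k) x  ≈⟨ +-congˡ (*-congˡ (eval-monomial k x)) ⟩
        - 1# + x ^ suc k                ≈⟨ +-congˡ (xᵏ⁺¹≈1 (∈-nonzeros⁻ x∈)) ⟩
        - 1# + 1#                       ≈⟨ -‿inverseˡ 1# ⟩
        0#                              ∎

      -1≈0 : suc k < #units → - 1# ≈ 0#
      -1≈0 k+1<#units = begin
        - 1#                              ≈⟨ +-identityʳ _ ⟨
        - 1# + 0#                         ≈⟨ +-congˡ (zeroˡ _) ⟨
        - 1# + 0# * eval (monomial k) 0#  ≈⟨ roots≥length⇒eval≈0 nonzeros p nonzeros-unique |p|≤|nonzeros| p-vanishes-on-units 0# ⟩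
        0#                                ∎
        where
          |p|≤|nonzeros| : length p ≤ #units
          |p|≤|nonzeros| = ≡.subst (_≤ #units) (≡.sym (≡.cong suc (length-monomial k))) k+1<#units

  units-exponent∣ : ∀ e → (∀ {x} → ¬ x ≈ 0# → x ^ e ≈ 1#) → #units ∣ e
  units-exponent∣ e xᵉ≈1 = by-remainder (e % #units) ≡.refl
    where
      by-remainder : ∀ k → e % #units ≡ k → #units ∣ e
      by-remainder zero    e%#units≡0 = m%n≡0⇒n∣m e #units e%#units≡0
      by-remainder (suc k) e%#units≡k = contradiction (#units≤exponent k xᵏ≈1) (<⇒≱ k<#units)
        where
          k<#units : suc k < #units
          k<#units = ≡.subst (_< #units) e%#units≡k (m%n<n e #units)

          xᵏ≈1 : ∀ {x} → ¬ x ≈ 0# → x ^ suc k ≈ 1#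
          xᵏ≈1 {x} x≉0 = ≡.subst (λ n → x ^ n ≈ 1#) e%#units≡k (trans (^-%-#units e x≉0) (xᵉ≈1 x≉0))

  roots-of-unity⊆⇒∣ : ∀ {s r} → s ∣ #units → (∀ ω → ω ^ s ≈ 1# → ω ^ r ≈ 1#) → s ∣ r
  roots-of-unity⊆⇒∣ (divides zero #units≡0) _ = contradiction #units≡0 (≢-nonZero⁻¹ #units)
  roots-of-unity⊆⇒∣ {s} {r} (divides m@(suc _) #units≡ms) ωˢ≈1⇒ωʳ≈1 =
    *-cancelˡ-∣ m (≡.subst (_∣ m ℕ.* r) #units≡ms (units-exponent∣ (m ℕ.* r) xᵐʳ≈1))
    where
      xᵐʳ≈1 : ∀ {x} → ¬ x ≈ 0# → x ^ (m ℕ.* r) ≈ 1#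
      xᵐʳ≈1 {x} x≉0 = begin
        x ^ (m ℕ.* r)  ≈⟨ ^-assocʳ x m r ⟨
        (x ^ m) ^ r    ≈⟨ ωˢ≈1⇒ωʳ≈1 (x ^ m) (begin
                            (x ^ m) ^ s    ≈⟨ ^-assocʳ x m s ⟩
                            x ^ (m ℕ.* s)  ≡⟨ ≡.cong (x ^_) #units≡ms ⟨
                            x ^ #units     ≈⟨ fermat x≉0 ⟩
                            1#             ∎) ⟩
        1#             ∎

  ∃-root-of-unity : ∀ {s r} → s ∣ #units → ¬ s ∣ r → ∃ λ ω → ω ^ s ≈ 1# × ¬ ω ^ r ≈ 1#
  -- _≟_ has no fixity declaration, so it would bind tighter than _^_.
  ∃-root-of-unity {s} {r} s∣#units s∤r with any? (λ ω → ((ω ^ s) ≟ 1#) ×-dec ¬? ((ω ^ r) ≟ 1#)) elems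
  ... | yes found = satisfied found
  ... | no  none  = contradiction (roots-of-unity⊆⇒∣ s∣#units ωˢ≈1⇒ωʳ≈1) s∤r
    where
      ωˢ≈1⇒ωʳ≈1 : ∀ ω → ω ^ s ≈ 1# → ω ^ r ≈ 1#
      ωˢ≈1⇒ωʳ≈1 ω ωˢ≈1 = decidable-stable ((ω ^ r) ≟ 1#) λ ωʳ≉1 →
        none (lose (λ ω≈η (ωˢ≈1 , ωʳ≉1) → trans (^-congˡ s (sym ω≈η)) ωˢ≈1 , ωʳ≉1 ∘ trans (^-congˡ r ω≈η))
                   (complete ω) (ωˢ≈1 , ωʳ≉1))

  insertNew-unique : ∀ {y ys} → Unique ys → Unique (insertNew y ys)
  insertNew-unique {y} {ys} ys! with y ∈? ys
  ... | yes _    = ys!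
  ... | no  y∉ys = All.tabulateₛ setoid (λ z∈ys y≈z → y∉ys (∈-resp-≈ setoid (sym y≈z) z∈ys)) ∷ ys!

  ∈-insertNew-new : ∀ {y ys} → y ∈ insertNew y ys
  ∈-insertNew-new {y} {ys} with y ∈? ys
  ... | yes y∈ys = y∈ys
  ... | no  _    = here refl

  ∈-insertNew-old : ∀ {y ys z} → z ∈ ys → z ∈ insertNew y ys
  ∈-insertNew-old {y} {ys} z∈ys with y ∈? ys
  ... | yes _ = z∈ys
  ... | no  _ = there z∈ys

  ∈-insertNew⁻ : ∀ {y ys z} → z ∈ insertNew y ys → z ≈ y ⊎ z ∈ ys
  ∈-insertNew⁻ {y} {ys} z∈ with y ∈? ys
  ∈-insertNew⁻ z∈ys           | yes _ = inj₂ z∈ys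
  ∈-insertNew⁻ (here z≈y)     | no  _ = inj₁ z≈y
  ∈-insertNew⁻ (there z∈ys)   | no  _ = inj₂ z∈ys

  values : (Carrier → Carrier) → List Carrier → List Carrier
  values f = foldr (λ x acc → insertNew (f x) acc) []

  values-unique : ∀ f xs → Unique (values f xs)
  values-unique f []       = []
  values-unique f (x ∷ xs) = insertNew-unique (values-unique f xs)

  ∈-values⁺ : ∀ f → (∀ {x y} → x ≈ y → f x ≈ f y) → ∀ {x} xs → x ∈ xs → f x ∈ values f xs
  ∈-values⁺ f f-cong (y ∷ xs) (here x≈y)  = ∈-resp-≈ setoid (f-cong (sym x≈y)) (∈-insertNew-new {ys = values f xs})
  ∈-values⁺ f f-cong (y ∷ xs) (there x∈xs) = ∈-insertNew-old {ys = values f xs} (∈-values⁺ f f-cong xs x∈xs)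

  ∈-values⁻ : ∀ f xs {v} → v ∈ values f xs → ∃ λ x → v ≈ f x
  ∈-values⁻ f (x ∷ xs) v∈ with ∈-insertNew⁻ {ys = values f xs} v∈
  ... | inj₁ v≈fx = x , v≈fx
  ... | inj₂ v∈xs = ∈-values⁻ f xs v∈xs

  S≈0-if-homogeneous : ∀ {ω ζ} f → (∀ {x y} → x ≈ y → f x ≈ f y) → ¬ ζ ≈ 0# → ¬ ζ ≈ 1# →
                       (∀ x → f (ω * x) ≈ ζ * f x) → S f ≈ 0#
  S≈0-if-homogeneous {ω} {ζ} f f-cong ζ≉0 ζ≉1 f-homogeneous =
    sum≈0-if-scaling-invariant (values-unique f elems) ζ≉0 ζ≉1 closed
    where
      closed : ∀ {v} → v ∈ valueSet f → ζ * v ∈ valueSet f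
      closed v∈ with x , v≈fx ← ∈-values⁻ f elems v∈ =
        ∈-resp-≈ setoid (trans (f-homogeneous x) (*-congˡ (sym v≈fx))) (∈-values⁺ f f-cong elems (complete (ω * x)))

  pow-cong : ∀ n {x y} → x ≈ y → pow x n ≈ pow y n
  pow-cong n {x} {y} x≈y = trans (pow≈^ x n) (trans (^-congˡ n x≈y) (sym (pow≈^ y n)))

  X^rB[X^s]-cong : ∀ s r B {x y} → x ≈ y → pow x r * eval B (pow x s) ≈ pow y r * eval B (pow y s)
  X^rB[X^s]-cong s r B x≈y = *-cong (pow-cong r x≈y) (eval-cong B (pow-cong s x≈y))

  X^rB[X^s]-homogeneous : ∀ {ω} s r B → ω ^ s ≈ 1# → ∀ x →
    pow (ω * x) r * eval B (pow (ω * x) s) ≈ ω ^ r * (pow x r * eval B (pow x s))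
  X^rB[X^s]-homogeneous {ω} s r B ωˢ≈1 x = begin
    pow (ω * x) r * eval B (pow (ω * x) s)    ≈⟨ *-cong (pow≈^ (ω * x) r) (eval-cong B (pow≈^ (ω * x) s)) ⟩
    (ω * x) ^ r * eval B ((ω * x) ^ s)        ≈⟨ *-cong (^-distrib-* ω x r) (eval-cong B (^-distrib-* ω x s)) ⟩
    (ω ^ r * x ^ r) * eval B (ω ^ s * x ^ s)  ≈⟨ *-congˡ (eval-cong B (trans (*-congʳ ωˢ≈1) (*-identityˡ _))) ⟩
    (ω ^ r * x ^ r) * eval B (x ^ s)          ≈⟨ *-assoc _ _ _ ⟩
    ω ^ r * (x ^ r * eval B (x ^ s))          ≈⟨ *-congˡ (*-cong (pow≈^ x r) (eval-cong B (pow≈^ x s))) ⟨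
    ω ^ r * (pow x r * eval B (pow x s))      ∎

  root-of-unity-nonzero : ∀ {ω s} → s ≥ 1 → ω ^ s ≈ 1# → ¬ ω ≈ 0#
  root-of-unity-nonzero {ω} {suc s} _ ωˢ≈1 ω≈0 = 0≉1 (begin
    0#           ≈⟨ zeroˡ (ω ^ s) ⟨
    0# * ω ^ s   ≈⟨ *-congʳ ω≈0 ⟨
    ω ^ suc s    ≈⟨ ωˢ≈1 ⟩
    1#           ∎)

proposition1p7 : ∀ {c ℓ : Level} (F : FiniteField c ℓ) (s r : ℕ) (B : List (FiniteField.Carrier F)) →
                 s ≥ 1 → s ∣ (FiniteField.card F ∸ 1) → r ≥ 1 → ¬ (s ∣ r) →
                 FiniteField._≈_ F
                   (FiniteField.S F (λ x → FiniteField._*_ F (FiniteField.pow F x r)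
                                             (FiniteField.eval F B (FiniteField.pow F x s))))
                   (FiniteField.0# F)
proposition1p7 F s r B s≥1 s∣q-1 _ s∤r
  with ω , ωˢ≈1 , ωʳ≉1 ← ∃-root-of-unity F (≡.subst (λ n → s ∣ n ∸ 1) (card≡1+#units F) s∣q-1) s∤r =
  S≈0-if-homogeneous F _ (X^rB[X^s]-cong F s r B) (^-nonzero F r (root-of-unity-nonzero F s≥1 ωˢ≈1)) ωʳ≉1
    (X^rB[X^s]-homogeneous F s r B ωˢ≈1)
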